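{- Let $G$ be a finite group with $|G|\ge 2$ and let $x\in G$ be such that $\deg(x)=\delta(\mathcal{G}(G))$ in the power graph $\mathcal{G}(G)$. Then $E[x,N(x)]$ is a minimum disconnecting set of $\mathcal{G}(G)$.
   Context: The power graph $\mathcal{G}(G)$ of a group $G$ has vertex set $G$, distinct $u,v$ adjacent iff one is a positive integer power of the other. $\delta$ denotes minimum degree, $N(x)$ the set of vertices adjacent to $x$, and for vertex sets $A,B$, $E[A,B]$ is the set of edges with one end in $A$ and the other in $B$ ($E[x,B]=E[\{x\},B]$). A disconnecting set of a graph is a set of edges whose removal increases the number of components; a minimum disconnecting set is one of least cardinality. -}

module Defs where

open import Data.Nat using (ℕ; zero; suc; _≤_)
open import Data.Fin using (Fin)
open import Data.Product using (Σ; ∃; _×_; _,_; proj₁; proj₂)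
open import Data.Sum using (_⊎_)
open import Data.List using (List; length)
open import Data.List.Membership.Propositional using (_∈_)
open import Data.List.Relation.Unary.All using (All)
open import Data.List.Relation.Unary.Unique.Propositional using (Unique)
open import Data.List.Relation.Unary.AllPairs using (AllPairs)
open import Relation.Binary.PropositionalEquality using (_≡_; _≢_)
open import Relation.Binary.Construct.Closure.ReflexiveTransitive using (Star)
open import Relation.Nullary using (¬_)
open import Function.Bundles using (_⇔_)
open import Algebra.Core using (Op₁; Op₂)
open import Algebra.Structures using (IsGroup)

record FiniteGroup (n : ℕ) : Set where
  field
    _∙_     : Op₂ (Fin n)
    ε       : Fin n
    _⁻¹     : Op₁ (Fin n)
    isGroup : IsGroup _≡_ _∙_ ε _⁻¹

module PowerGraph {n : ℕ} (G : FiniteGroup n) where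
  open FiniteGroup G

  -- positive powers: pow x k = x^(k+1)
  pow : Fin n → ℕ → Fin n
  pow x zero    = x
  pow x (suc k) = pow x k ∙ x

  IsPowerOf : Fin n → Fin n → Set
  IsPowerOf v u = ∃ λ k → v ≡ pow u k

  Adj : Fin n → Fin n → Set
  Adj u v = u ≢ v × (IsPowerOf v u ⊎ IsPowerOf u v)

  HasSize : (Fin n → Set) → ℕ → Set
  HasSize P d = Σ (List (Fin n)) λ xs →
    Unique xs × length xs ≡ d × (∀ y → (y ∈ xs) ⇔ P y)

  HasDegree : Fin n → ℕ → Set
  HasDegree x d = HasSize (Adj x) d

  HasMinDegree : Fin n → Set
  HasMinDegree x = Σ ℕ λ d → HasDegree x d × (∀ y d' → HasDegree y d' → d ≤ d')

  -- Edge sets: lists of ordered pairs, each read as the unordered edge {u,v}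
  EdgeList : Set
  EdgeList = List (Fin n × Fin n)

  InE : Fin n → Fin n → EdgeList → Set
  InE u v F = ((u , v) ∈ F) ⊎ ((v , u) ∈ F)

  SameEdge : Fin n × Fin n → Fin n × Fin n → Set
  SameEdge (u , v) (u' , v') = (u ≡ u' × v ≡ v') ⊎ (u ≡ v' × v ≡ u')

  DistinctEdges : EdgeList → Set
  DistinctEdges F = AllPairs (λ e e' → ¬ SameEdge e e') F

  EdgesOfGraph : EdgeList → Set
  EdgesOfGraph F = All (λ e → Adj (proj₁ e) (proj₂ e)) F

  AdjWithout : EdgeList → Fin n → Fin n → Set
  AdjWithout F u v = Adj u v × ¬ InE u v F

  Connected : Fin n → Fin n → Set
  Connected = Star Adj

  ConnectedWithout : EdgeList → Fin n → Fin n → Set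
  ConnectedWithout F = Star (AdjWithout F)

  -- removing F increases the number of components, i.e. two vertices
  -- in a common component of 𝒢(G) lie in different components of 𝒢(G) − F
  Disconnecting : EdgeList → Set
  Disconnecting F = EdgesOfGraph F ×
    (∃ λ u → ∃ λ v → Connected u v × ¬ ConnectedWithout F u v)

  MinimumDisconnecting : EdgeList → Set
  MinimumDisconnecting F = Disconnecting F ×
    (∀ F' → Disconnecting F' → length F ≤ length F')

  IsEdgesToNbhd : Fin n → EdgeList → Set
  IsEdgesToNbhd x F = DistinctEdges F ×
    (∀ u v → InE u v F ⇔ ((u ≡ x × Adj x v) ⊎ (v ≡ x × Adj x u)))

-- The identity ε is adjacent to every other vertex of 𝒢(G). If removing F'
-- separates two vertices, one of them, s, is cut off from ε; then for every
-- neighbour w of s, F' contains {s,w} or {w,ε}, and distinct neighbours give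
-- distinct edges. Hence |F'| ≥ deg(s) ≥ δ = |E[x,N(x)]|. Conversely E[x,N(x)]
-- disconnects 𝒢(G) because it isolates x, which has a neighbour once |G| ≥ 2.
module Submission where

open import Defs
open import Algebra.Bundles using (Group)
open import Algebra.Structures using (IsGroup)
import Algebra.Properties.Group as GroupProperties
open import Data.Bool using (if_then_else_)
open import Data.Empty using (⊥-elim)
open import Data.Fin using (Fin; zero; suc; toℕ; fromℕ<)
open import Data.Fin.Properties using (_≟_; pigeonhole; any?; toℕ-fromℕ<)
open import Data.List using (List; _∷_; length; map; filter; allFin)
open import Data.List.Properties using (length-map; length-removeAt′)
open import Data.List.Membership.Propositional using (_∈_)
open import Data.List.Membership.Propositional.Properties
  using (∈-filter⁺; ∈-filter⁻; ∈-allFin; ∈-map⁺; ∈-map⁻)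
open import Data.Product.Properties using (≡-dec)
import Data.List.Membership.DecPropositional as DecMembership
open import Data.List.Relation.Binary.Subset.Propositional using (_⊆_)
open import Data.List.Relation.Unary.All as All using (All; []; _∷_)
import Data.List.Relation.Unary.All.Properties as All
open import Data.List.Relation.Unary.AllPairs using (AllPairs; []; _∷_)
open import Data.List.Relation.Unary.Any using (here; there; index; _─_)
open import Data.List.Relation.Unary.Unique.Propositional using (Unique)
open import Data.List.Relation.Unary.Unique.Propositional.Properties using (allFin⁺; filter⁺)
open import Data.Nat using (ℕ; zero; suc; _+_; _≤_; z≤n; s≤s; _≤?_)
open import Data.Nat.Properties
  using (+-identityʳ; +-suc; ≤-trans; n<1+n; m≤n⇒m<n∨m≡n; m≤n⇒∃[o]m+o≡n; module ≤-Reasoning)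
open import Data.Product using (∃; _×_; _,_; proj₁; proj₂)
open import Data.Sum using (_⊎_; inj₁; inj₂; swap)
open import Function using (_∘_; _⇔_; Equivalence; mk⇔)
open import Relation.Binary.Construct.Closure.ReflexiveTransitive
  using (_◅_; _◅◅_; reverse) renaming (ε to nil)
open import Relation.Binary.PropositionalEquality
  using (_≡_; _≢_; refl; sym; trans; cong; subst; ≢-sym; module ≡-Reasoning)
open import Relation.Nullary using (¬_; Dec; yes; no; does; contradiction; ¬?)
open import Relation.Nullary.Decidable using (_×-dec_; _⊎-dec_; map′; dec-true; dec-false; decidable-stable)

module _ {A : Set} where

  ∈-─ : ∀ {y z} {zs : List A} (y∈zs : y ∈ zs) → z ∈ zs → z ≢ y → z ∈ (zs ─ y∈zs)
  ∈-─ (here refl)  (here refl)  z≢y = contradiction refl z≢y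
  ∈-─ (here refl)  (there z∈zs) _   = z∈zs
  ∈-─ (there _)    (here refl)  _   = here refl
  ∈-─ (there y∈zs) (there z∈zs) z≢y = there (∈-─ y∈zs z∈zs z≢y)

  unique⊆⇒length≤ : ∀ {xs ys : List A} → Unique xs → xs ⊆ ys → length xs ≤ length ys
  unique⊆⇒length≤ [] _ = z≤n
  unique⊆⇒length≤ {x ∷ xs} {ys} (x∉xs ∷ xs-unique) xs⊆ys = begin
    length (x ∷ xs)          ≤⟨ s≤s (unique⊆⇒length≤ xs-unique xs⊆ys─x) ⟩
    suc (length (ys ─ x∈ys)) ≡⟨ length-removeAt′ ys (index x∈ys) ⟨
    length ys                ∎
    where
    open ≤-Reasoning
    x∈ys : x ∈ ys
    x∈ys = xs⊆ys (here refl)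
    xs⊆ys─x : xs ⊆ (ys ─ x∈ys)
    xs⊆ys─x y∈xs = ∈-─ x∈ys (xs⊆ys (there y∈xs)) (≢-sym (All.lookup x∉xs y∈xs))

module _ {A B : Set} {P : A → Set} {R : A → A → Set} (f : A → B) where

  unique-map⁺ : (∀ {a b} → P a → P b → f a ≡ f b → R a b) →
                ∀ {xs} → All P xs → AllPairs (λ a b → ¬ R a b) xs → Unique (map f xs)
  unique-map⁺ f-injective [] [] = []
  unique-map⁺ f-injective (pa ∷ ps) (¬ra ∷ ¬rs) =
    All.map⁺ (All.zipWith (λ (pb , ¬rab) → ¬rab ∘ f-injective pa pb) (ps , ¬ra))
    ∷ unique-map⁺ f-injective ps ¬rs

other-element : ∀ {m} → 2 ≤ m → (a : Fin m) → ∃ (_≢ a)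
other-element (s≤s (s≤s z≤n)) zero    = suc zero , λ ()
other-element (s≤s (s≤s z≤n)) (suc _) = zero , λ ()

module _ {n : ℕ} (G : FiniteGroup n) where
  open FiniteGroup G
  open PowerGraph G
  open IsGroup isGroup using (assoc; identityˡ)

  private
    group : Group _ _
    group = record { isGroup = isGroup }

  open GroupProperties group using (identityʳ-unique)
  open DecMembership (≡-dec (_≟_ {n}) (_≟_ {n})) using (_∈?_)

  pow-+ : ∀ w i j → pow w (suc (i + j)) ≡ pow w i ∙ pow w j
  pow-+ w i zero    = cong (λ k → pow w k ∙ w) (+-identityʳ i)
  pow-+ w i (suc j) = begin
    pow w (suc (i + suc j)) ≡⟨ cong (pow w ∘ suc) (+-suc i j) ⟩
    pow w (suc (i + j)) ∙ w ≡⟨ cong (_∙ w) (pow-+ w i j) ⟩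
    (pow w i ∙ pow w j) ∙ w ≡⟨ assoc _ _ _ ⟩
    pow w i ∙ pow w (suc j) ∎
    where open ≡-Reasoning

  pow-finiteOrder : ∀ w → ∃ λ m → pow w m ≡ ε
  pow-finiteOrder w with pigeonhole (n<1+n n) (λ (i : Fin (suc n)) → pow w (toℕ i))
  ... | i , j , i<j , powᵢ≡powⱼ with m≤n⇒∃[o]m+o≡n i<j
  ... | m , 1+i+m≡j = m , identityʳ-unique (pow w (toℕ i)) (pow w m) (begin
    pow w (toℕ i) ∙ pow w m ≡⟨ pow-+ w (toℕ i) m ⟨
    pow w (suc (toℕ i + m)) ≡⟨ cong (pow w) 1+i+m≡j ⟩
    pow w (toℕ j)           ≡⟨ powᵢ≡powⱼ ⟨
    pow w (toℕ i)           ∎)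
    where open ≡-Reasoning

  pow-reduce : ∀ {u m} → pow u m ≡ ε → ∀ k → ∃ λ r → r ≤ m × pow u k ≡ pow u r
  pow-reduce powₘ≡ε zero = zero , z≤n , refl
  pow-reduce {u} {m} powₘ≡ε (suc k) with pow-reduce powₘ≡ε k
  ... | r , r≤m , powₖ≡powᵣ with m≤n⇒m<n∨m≡n r≤m
  ...   | inj₁ r<m  = suc r , r<m , cong (_∙ u) powₖ≡powᵣ
  ...   | inj₂ refl = zero , z≤n , (begin
    pow u k ∙ u ≡⟨ cong (_∙ u) (trans powₖ≡powᵣ powₘ≡ε) ⟩
    ε ∙ u       ≡⟨ identityˡ u ⟩
    u           ∎)
    where open ≡-Reasoning

  isPowerOf? : ∀ v u → Dec (IsPowerOf v u)
  isPowerOf? v u with pow-finiteOrder u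
  ... | m , powₘ≡ε = map′ (λ (i , v≡powᵢ) → toℕ i , v≡powᵢ) bounded
                        (any? λ (i : Fin (suc m)) → v ≟ pow u (toℕ i))
    where
    bounded : IsPowerOf v u → ∃ λ (i : Fin (suc m)) → v ≡ pow u (toℕ i)
    bounded (k , v≡powₖ) with pow-reduce powₘ≡ε k
    ... | r , r≤m , powₖ≡powᵣ =
      fromℕ< (s≤s r≤m) , trans v≡powₖ (trans powₖ≡powᵣ (cong (pow u) (sym (toℕ-fromℕ< (s≤s r≤m)))))

  adj? : ∀ u v → Dec (Adj u v)
  adj? u v = ¬? (u ≟ v) ×-dec (isPowerOf? v u ⊎-dec isPowerOf? u v)

  adj-sym : ∀ {u v} → Adj u v → Adj v u
  adj-sym (u≢v , power) = ≢-sym u≢v , swap power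

  adjWithout-sym : ∀ F {u v} → AdjWithout F u v → AdjWithout F v u
  adjWithout-sym F (u~v , uv∉F) = adj-sym u~v , uv∉F ∘ swap

  adj-ε : ∀ {w} → w ≢ ε → Adj w ε
  adj-ε {w} w≢ε = w≢ε , inj₁ (proj₁ (pow-finiteOrder w) , sym (proj₂ (pow-finiteOrder w)))

  has-neighbour : 2 ≤ n → ∀ x → ∃ (Adj x)
  has-neighbour 2≤n x with x ≟ ε
  ... | no x≢ε  = ε , adj-ε x≢ε
  ... | yes refl with other-element 2≤n ε
  ...   | y , y≢ε = y , adj-sym (adj-ε y≢ε)

  neighbours : Fin n → List (Fin n)
  neighbours s = filter (adj? s) (allFin n)

  neighbours-unique : ∀ s → Unique (neighbours s)
  neighbours-unique s = filter⁺ (adj? s) (allFin⁺ n)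

  ∈-neighbours : ∀ s w → w ∈ neighbours s ⇔ Adj s w
  ∈-neighbours s w = mk⇔ (proj₂ ∘ ∈-filter⁻ (adj? s) {xs = allFin n}) (∈-filter⁺ (adj? s) (∈-allFin w))

  neighbours-degree : ∀ s → HasDegree s (length (neighbours s))
  neighbours-degree s = neighbours s , neighbours-unique s , refl , ∈-neighbours s

  InE? : ∀ u v F → Dec (InE u v F)
  InE? u v F = (u , v) ∈? F ⊎-dec (v , u) ∈? F

  -- Inverts the choice, for each neighbour w of s, of an F-edge on the path
  -- s – w – ε: the end other than s, or other than ε if s is not an end.
  blockedNeighbour : Fin n → Fin n × Fin n → Fin n
  blockedNeighbour s (a , b) =
    if does (a ≟ s) then b else if does (b ≟ s) then a else if does (a ≟ ε) then b else a

  module _ (s : Fin n) {w : Fin n} where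

    blockedNeighbour-sw : blockedNeighbour s (s , w) ≡ w
    blockedNeighbour-sw rewrite dec-true (s ≟ s) refl = refl

    blockedNeighbour-ws : w ≢ s → blockedNeighbour s (w , s) ≡ w
    blockedNeighbour-ws w≢s rewrite dec-false (w ≟ s) w≢s | dec-true (s ≟ s) refl = refl

    blockedNeighbour-wε : s ≢ ε → w ≢ s → w ≢ ε → blockedNeighbour s (w , ε) ≡ w
    blockedNeighbour-wε s≢ε w≢s w≢ε
      rewrite dec-false (w ≟ s) w≢s | dec-false (ε ≟ s) (≢-sym s≢ε) | dec-false (w ≟ ε) w≢ε = refl

    blockedNeighbour-εw : s ≢ ε → w ≢ s → blockedNeighbour s (ε , w) ≡ w
    blockedNeighbour-εw s≢ε w≢s
      rewrite dec-false (ε ≟ s) (≢-sym s≢ε) | dec-false (w ≟ s) w≢s | dec-true (ε ≟ ε) refl = refl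

  separated⇒≢ : ∀ F {s t} → ¬ ConnectedWithout F s t → s ≢ t
  separated⇒≢ F s↛t refl = s↛t nil

  blocking-edge : ∀ F {s w} → ¬ ConnectedWithout F s ε → Adj s w →
                  ∃ λ p → p ∈ F × blockedNeighbour s p ≡ w
  blocking-edge F {s} {w} s↛ε s~w = edge (InE? s w F) (InE? w ε F)
    where
    s≢ε : s ≢ ε
    s≢ε = separated⇒≢ F s↛ε
    w≢s : w ≢ s
    w≢s = ≢-sym (proj₁ s~w)
    w≢ε : ¬ InE s w F → w ≢ ε
    w≢ε sw∉F = separated⇒≢ F (s↛ε ∘ ((s~w , sw∉F) ◅_))
    edge : Dec (InE s w F) → Dec (InE w ε F) → ∃ λ p → p ∈ F × blockedNeighbour s p ≡ w
    edge (yes (inj₁ sw∈F)) _                = _ , sw∈F , blockedNeighbour-sw s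
    edge (yes (inj₂ ws∈F)) _                = _ , ws∈F , blockedNeighbour-ws s w≢s
    edge (no sw∉F)         (yes (inj₁ wε∈F)) = _ , wε∈F , blockedNeighbour-wε s s≢ε w≢s (w≢ε sw∉F)
    edge (no sw∉F)         (yes (inj₂ εw∈F)) = _ , εw∈F , blockedNeighbour-εw s s≢ε w≢s
    edge (no sw∉F)         (no wε∉F)         =
      ⊥-elim (s↛ε ((s~w , sw∉F) ◅ (adj-ε (w≢ε sw∉F) , wε∉F) ◅ nil))

  separated-from-ε⇒degree≤ : ∀ F {s} → ¬ ConnectedWithout F s ε → length (neighbours s) ≤ length F
  separated-from-ε⇒degree≤ F {s} s↛ε = begin
    length (neighbours s)               ≤⟨ unique⊆⇒length≤ (neighbours-unique s) neighbours⊆blocked ⟩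
    length (map (blockedNeighbour s) F) ≡⟨ length-map (blockedNeighbour s) F ⟩
    length F                            ∎
    where
    open ≤-Reasoning
    neighbours⊆blocked : neighbours s ⊆ map (blockedNeighbour s) F
    neighbours⊆blocked {w} w∈N with blocking-edge F s↛ε (Equivalence.to (∈-neighbours s w) w∈N)
    ... | p , p∈F , refl = ∈-map⁺ (blockedNeighbour s) p∈F

  -- Some endpoint of the separated pair is cut off from ε. Finding it is a
  -- classical case split, admissible here because the goal is decidable.
  disconnecting⇒minDegree≤ : ∀ {d F} → (∀ s → d ≤ length (neighbours s)) → Disconnecting F → d ≤ length F
  disconnecting⇒minDegree≤ {d} {F} d≤degree (_ , u , v , _ , u↛v) =
    decidable-stable (d ≤? length F) λ d≰F →
      let reaches-ε : ∀ s → ¬ ¬ ConnectedWithout F s ε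
          reaches-ε s s↛ε = d≰F (≤-trans (d≤degree s) (separated-from-ε⇒degree≤ F s↛ε))
      in reaches-ε u λ u↝ε → reaches-ε v λ v↝ε → u↛v (u↝ε ◅◅ reverse (adjWithout-sym F) v↝ε)

  Incident : Fin n → Fin n × Fin n → Set
  Incident x (u , v) = (u ≡ x × Adj x v) ⊎ (v ≡ x × Adj x u)

  otherEnd : Fin n → Fin n × Fin n → Fin n
  otherEnd x (u , v) = if does (u ≟ x) then v else u

  incident⇒adj : ∀ {x p} → Incident x p → Adj (proj₁ p) (proj₂ p)
  incident⇒adj (inj₁ (refl , x~v)) = x~v
  incident⇒adj (inj₂ (refl , x~u)) = adj-sym x~u

  incident-otherEnd : ∀ {x p} → Incident x p → SameEdge p (x , otherEnd x p) × Adj x (otherEnd x p)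
  incident-otherEnd {x} (inj₁ (refl , x~v)) rewrite dec-true (x ≟ x) refl = inj₁ (refl , refl) , x~v
  incident-otherEnd {x} {u , _} (inj₂ (refl , x~u@(x≢u , _)))
    rewrite dec-false (u ≟ x) (≢-sym x≢u) = inj₂ (refl , refl) , x~u

  sameEdge-sym : ∀ {p q} → SameEdge p q → SameEdge q p
  sameEdge-sym (inj₁ (refl , refl)) = inj₁ (refl , refl)
  sameEdge-sym (inj₂ (refl , refl)) = inj₂ (refl , refl)

  sameEdge-trans : ∀ {p q r} → SameEdge p q → SameEdge q r → SameEdge p r
  sameEdge-trans (inj₁ (refl , refl)) q≈r                  = q≈r
  sameEdge-trans (inj₂ (refl , refl)) (inj₁ (refl , refl)) = inj₂ (refl , refl)
  sameEdge-trans (inj₂ (refl , refl)) (inj₂ (refl , refl)) = inj₁ (refl , refl)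

  otherEnd-injective : ∀ {x p q} → Incident x p → Incident x q → otherEnd x p ≡ otherEnd x q → SameEdge p q
  otherEnd-injective {x} p-inc q-inc eq = sameEdge-trans (proj₁ (incident-otherEnd p-inc))
    (subst (λ w → SameEdge (x , w) _) (sym eq) (sameEdge-sym (proj₁ (incident-otherEnd q-inc))))

  module _ {x F} (F-spec : IsEdgesToNbhd x F) where

    private
      ∈F⇔incident : ∀ u v → InE u v F ⇔ Incident x (u , v)
      ∈F⇔incident = proj₂ F-spec

    edgesToNbhd-incident : All (Incident x) F
    edgesToNbhd-incident = All.tabulate λ {(u , v)} uv∈F → Equivalence.to (∈F⇔incident u v) (inj₁ uv∈F)

    edgesToNbhd-length≤ : ∀ {d} → HasDegree x d → length F ≤ d
    edgesToNbhd-length≤ {d} (xs , _ , |xs|≡d , ∈xs⇔adj) = begin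
      length F                    ≡⟨ length-map (otherEnd x) F ⟨
      length (map (otherEnd x) F) ≤⟨ unique⊆⇒length≤ otherEnds-unique otherEnds⊆xs ⟩
      length xs                   ≡⟨ |xs|≡d ⟩
      d                           ∎
      where
      open ≤-Reasoning
      otherEnds-unique : Unique (map (otherEnd x) F)
      otherEnds-unique = unique-map⁺ (otherEnd x) otherEnd-injective edgesToNbhd-incident (proj₁ F-spec)
      otherEnds⊆xs : map (otherEnd x) F ⊆ xs
      otherEnds⊆xs w∈ with ∈-map⁻ (otherEnd x) w∈
      ... | p , p∈F , refl =
        Equivalence.from (∈xs⇔adj _) (proj₂ (incident-otherEnd (All.lookup edgesToNbhd-incident p∈F)))

    edgesToNbhd-isolates : ∀ {y} → ConnectedWithout F x y → x ≡ y
    edgesToNbhd-isolates nil                = refl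
    edgesToNbhd-isolates ((x~z , xz∉F) ◅ _) =
      ⊥-elim (xz∉F (Equivalence.from (∈F⇔incident x _) (inj₁ (refl , x~z))))

    edgesToNbhd-disconnecting : 2 ≤ n → Disconnecting F
    edgesToNbhd-disconnecting 2≤n with has-neighbour 2≤n x
    ... | y , x~y@(x≢y , _) =
      All.map incident⇒adj edgesToNbhd-incident , x , y , x~y ◅ nil , x≢y ∘ edgesToNbhd-isolates

lemma3p3 : (n : ℕ) → 2 ≤ n → (G : FiniteGroup n) → (x : Fin n) →
    PowerGraph.HasMinDegree G x →
    (F : PowerGraph.EdgeList G) → PowerGraph.IsEdgesToNbhd G x F →
    PowerGraph.MinimumDisconnecting G F
lemma3p3 n 2≤n G x (d , x-degree , d-minimal) F F-spec =
  edgesToNbhd-disconnecting G F-spec 2≤n ,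
  λ F' F'-disconnecting → ≤-trans (edgesToNbhd-length≤ G F-spec x-degree)
    (disconnecting⇒minDegree≤ G (λ s → d-minimal s _ (neighbours-degree G s)) F'-disconnecting)
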